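{- Let $\mathsf{B}_1,\dots,\mathsf{B}_l$ be an OBDD refutation of $\mathsf{PHP}_n$ (for some total order on the variables), and let $R\subseteq \mathsf{Cls}(\mathsf{PC}_n)$ with $|R|>4$. Then there is $i<l$ such that $|R|/4\le |\mathsf{Cls}(\mathsf{B}_i)\cap R|<2|R|/4$.
   Context: The pigeonhole formula is the CNF $\mathsf{PHP}_n=\mathsf{PC}_n\wedge \mathsf{NC}_n$ over variables $P_{ij}$ ($1\le i\le n+1$, $1\le j\le n$), with $\mathsf{PC}_n=\bigwedge_{i=1}^{n+1}\big(\bigvee_{j=1}^{n}P_{ij}\big)$ and $\mathsf{NC}_n=\bigwedge_{1\le i<j\le n+1,\ 1\le k\le n}(\lnot P_{ik}\vee\lnot P_{jk})$. For a CNF $\varphi$, $\mathsf{Cls}(\varphi)$ is its set of clauses. Given a total order $\prec$ on the variables, an OBDD refutation of an unsatisfiable CNF $\varphi$ is a sequence of (reduced, ordered w.r.t. $\prec$) OBDDs $\mathsf{B}_1(\varphi_1),\dots,\mathsf{B}_l(\varphi_l)$, $\mathsf{B}_i$ representing the CNF $\varphi_i$, such that $\mathsf{B}_l$ represents the constant false and for each $i$ exactly one holds: (Axiom) $\varphi_i$ is a single clause of $\varphi$; (Join) $\varphi_i=\varphi_{i'}\wedge\varphi_{i''}$ for some $1\le i'<i''<i$. Here $\mathsf{Cls}(\mathsf{B}_i)$ denotes $\mathsf{Cls}(\varphi_i)$, the set of clauses of $\varphi$ conjoined in $\varphi_i$. -}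

module Defs where

open import Data.Nat using (ℕ; zero; suc; _<_)
open import Data.Bool using (Bool; true; false; if_then_else_; _∨_)
open import Data.Fin using (Fin; fromℕ)
import Data.Fin as F
open import Data.Fin.Subset using (Subset)
open import Data.Vec using (tabulate)
open import Data.Product using (_×_; Σ; ∃; _,_)
open import Data.Sum using (_⊎_)
open import Data.Unit using (⊤)
open import Relation.Binary.PropositionalEquality using (_≡_)
open import Function.Definitions using (Injective)

-- Variables P_ij, pigeon i ∈ {1..n+1} (Fin (suc n)), hole j ∈ {1..n} (Fin n).
Var : ℕ → Set
Var n = Fin (suc n) × Fin n

Assignment : ℕ → Set
Assignment n = Var n → Bool

-- Clauses of PHP_n:  pc i  = (P_i1 ∨ … ∨ P_in)          (clauses of PC_n)
--                    nc i j k = (¬P_ik ∨ ¬P_jk), i < j  (clauses of NC_n)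
data Clause (n : ℕ) : Set where
  pc : Fin (suc n) → Clause n
  nc : (i j : Fin (suc n)) → i F.< j → Fin n → Clause n

Sat : {n : ℕ} → Assignment n → Clause n → Set
Sat {n} ρ (pc i) = Σ (Fin n) λ j → ρ (i , j) ≡ true
Sat ρ (nc i j _ k) = ρ (i , k) ≡ false ⊎ ρ (j , k) ≡ false

-- A sub-CNF of PHP_n, given by its set of clauses Cls(φ) ⊆ Cls(PHP_n).
ClauseSet : ℕ → Set
ClauseSet n = Clause n → Bool

-- A total order ≺ on the variables, given by an injective rank function:
-- x ≺ y  iff  rank x < rank y.
record VarOrder (n : ℕ) : Set where
  field
    rank : Var n → ℕ
    rank-inj : Injective _≡_ _≡_ rank

data BDD (n : ℕ) : Set where
  leaf : Bool → BDD n
  node : Var n → BDD n → BDD n → BDD n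

evalB : {n : ℕ} → BDD n → Assignment n → Bool
evalB (leaf b) ρ = b
evalB (node x lo hi) ρ = if ρ x then evalB hi ρ else evalB lo ρ

Above : {n : ℕ} → VarOrder n → ℕ → BDD n → Set
Above O r (leaf _) = ⊤
Above O r (node x lo hi) =
  r < VarOrder.rank O x × Above O (VarOrder.rank O x) lo × Above O (VarOrder.rank O x) hi

Ordered : {n : ℕ} → VarOrder n → BDD n → Set
Ordered O (leaf _) = ⊤
Ordered O (node x lo hi) = Above O (VarOrder.rank O x) lo × Above O (VarOrder.rank O x) hi

-- reduced: no redundant test (in tree form isomorphic subgraphs are
-- identified by structural equality, so this is the only reduction rule)
Reduced : {n : ℕ} → BDD n → Set
Reduced (leaf _) = ⊤
Reduced (node x lo hi) = (lo ≡ hi → Data.Empty.⊥) × Reduced lo × Reduced hi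
  where import Data.Empty

Represents : {n : ℕ} → BDD n → ClauseSet n → Set
Represents {n} B φ = (ρ : Assignment n) →
  (evalB B ρ ≡ true → (c : Clause n) → φ c ≡ true → Sat ρ c) ×
  (((c : Clause n) → φ c ≡ true → Sat ρ c) → evalB B ρ ≡ true)

IsAxiom : {n : ℕ} → ClauseSet n → Set
IsAxiom {n} φ = Σ (Clause n) λ c → φ c ≡ true × ((d : Clause n) → φ d ≡ true → d ≡ c)

IsJoin : {n m : ℕ} → (Fin m → ClauseSet n) → Fin m → Set
IsJoin {n} {m} cls k = Σ (Fin m) λ a → Σ (Fin m) λ b →
  a F.< b × b F.< k × ((d : Clause n) → cls k d ≡ (cls a d ∨ cls b d))

-- An OBDD refutation B_1,…,B_l of PHP_n w.r.t. the order O, with l = suc m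
-- (steps indexed 0,…,m; the last one, index m, is B_l).
record Refutation (n : ℕ) (O : VarOrder n) (m : ℕ) : Set where
  field
    B          : Fin (suc m) → BDD n
    cls        : Fin (suc m) → ClauseSet n
    ordered    : (k : Fin (suc m)) → Ordered O (B k)
    reduced    : (k : Fin (suc m)) → Reduced (B k)
    represents : (k : Fin (suc m)) → Represents (B k) (cls k)
    step       : (k : Fin (suc m)) → IsAxiom (cls k) ⊎ IsJoin cls k
    final      : (ρ : Assignment n) → evalB (B (fromℕ m)) ρ ≡ false

-- Cls(φ) ∩ R for R ⊆ Cls(PC_n) (R given as a set of pigeons i, i.e. of clauses pc i)
PCPart : {n : ℕ} → ClauseSet n → Subset (suc n)
PCPart φ = tabulate (λ i → φ (pc i))

-- Write μ(k) = |Cls(B_k) ∩ R|.  The proof has three ingredients.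
--   * Counting: μ ≤ 1 at an axiom step (a single clause), and μ is
--     subadditive along a join, μ(k) ≤ μ(a) + μ(b).
--   * Semantics: for each pigeon i the assignment "pigeon i stays home,
--     the others fly injectively via punchOut" satisfies every clause of
--     PHP_n except pc i.  Since B_l is unsatisfiable, its clause set must
--     therefore contain every pc i, so μ(l) = |R|.
--   * Descent: in any derivation whose leaves have measure < N/4 and whose
--     joins are subadditive, a step of measure ≥ N/4 has an ancestor of
--     measure in [N/4, N/2): walk down into a premise of measure ≥ N/4
--     for as long as one exists; where none does, subadditivity bounds
--     the measure by N/2.
-- Starting the descent at the last step, and noting that the last step
-- itself (with μ = |R|) is not balanced, yields the theorem.
module Submission where

open import Defs
open import Data.Nat using (ℕ; zero; suc; _<_; _≤_; _*_; _+_; _≤?_; z≤n; s≤s)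
open import Data.Nat.Properties
  using (≤-trans; ≤-<-trans; ≤-reflexive; <⇒≱; ≰⇒>; +-suc; +-monoʳ-≤; +-mono-<; +-identityʳ;
         *-monoʳ-≤; *-monoˡ-≤; *-distribˡ-+; m≤n*m; module ≤-Reasoning)
open import Data.Fin using (Fin; inject₁; toℕ; fromℕ; lower₁; punchOut; _≟_)
import Data.Fin as F
import Data.Fin.Properties as FinP
open import Data.Fin.Induction using (<-wellFounded)
open import Data.Fin.Subset using (Subset; ∣_∣; _∩_; _∪_; _∈_; _⊆_; ⁅_⁆; inside; outside)
open import Data.Fin.Subset.Properties
  using (p⊆q⇒∣p∣≤∣q∣; ∣p∣≤∣x∷p∣; ∣p∩q∣≤∣p∣; ∣⁅x⁆∣≡1; ∣⊥∣≡0; x∈⁅x⁆; nonempty?; Empty-unique; x∈p∩q⁺;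
         ∩-distribʳ-∪)
open import Data.Vec using ([]; _∷_; tabulate)
open import Data.Vec.Properties using (lookup∘tabulate; tabulate-cong; []=⇒lookup; lookup⇒[]=)
open import Data.Product using (Σ; _×_; _,_; proj₂)
open import Data.Sum using (_⊎_; inj₁; inj₂)
open import Data.Bool using (Bool; true; false; _∨_)
open import Data.Empty using (⊥-elim)
open import Induction.WellFounded using (Acc; acc)
open import Relation.Nullary using (yes; no; ¬_)
open import Relation.Binary.PropositionalEquality

∈-tabulate⁺ : ∀ {k} (f : Fin k → Bool) {x : Fin k} → f x ≡ true → x ∈ tabulate f
∈-tabulate⁺ f {x} fx = lookup⇒[]= x (tabulate f) (trans (lookup∘tabulate f x) fx)

∈-tabulate⁻ : ∀ {k} (f : Fin k → Bool) {x : Fin k} → x ∈ tabulate f → f x ≡ true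
∈-tabulate⁻ f {x} x∈ = trans (sym (lookup∘tabulate f x)) ([]=⇒lookup x∈)

tabulate-∨ : ∀ {k} (f g : Fin k → Bool) → tabulate (λ x → f x ∨ g x) ≡ tabulate f ∪ tabulate g
tabulate-∨ {zero}  f g = refl
tabulate-∨ {suc k} f g = cong ((f F.zero ∨ g F.zero) ∷_) (tabulate-∨ (λ x → f (F.suc x)) (λ x → g (F.suc x)))

∣p∪q∣≤∣p∣+∣q∣ : ∀ {k} (p q : Subset k) → ∣ p ∪ q ∣ ≤ ∣ p ∣ + ∣ q ∣
∣p∪q∣≤∣p∣+∣q∣ []            []            = z≤n
∣p∪q∣≤∣p∣+∣q∣ (outside ∷ p) (outside ∷ q) = ∣p∪q∣≤∣p∣+∣q∣ p q
∣p∪q∣≤∣p∣+∣q∣ (outside ∷ p) (inside  ∷ q) =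
  ≤-trans (s≤s (∣p∪q∣≤∣p∣+∣q∣ p q)) (≤-reflexive (sym (+-suc ∣ p ∣ ∣ q ∣)))
∣p∪q∣≤∣p∣+∣q∣ (inside  ∷ p) (y       ∷ q) =
  s≤s (≤-trans (∣p∪q∣≤∣p∣+∣q∣ p q) (+-monoʳ-≤ ∣ p ∣ (∣p∣≤∣x∷p∣ y q)))

subsingleton⇒∣p∣≤1 : ∀ {k} (p : Subset k) → (∀ {x y} → x ∈ p → y ∈ p → x ≡ y) → ∣ p ∣ ≤ 1
subsingleton⇒∣p∣≤1 {k} p unique with nonempty? p
... | yes (x , x∈p) = ≤-trans (p⊆q⇒∣p∣≤∣q∣ p⊆⁅x⁆) (≤-reflexive (∣⁅x⁆∣≡1 x))
  where
  p⊆⁅x⁆ : p ⊆ ⁅ x ⁆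
  p⊆⁅x⁆ y∈p = subst (_∈ ⁅ x ⁆) (unique x∈p y∈p) (x∈⁅x⁆ x)
... | no empty = ≤-trans (≤-reflexive (trans (cong ∣_∣ (Empty-unique empty)) (∣⊥∣≡0 k))) z≤n

μ : {n : ℕ} → Subset (suc n) → ClauseSet n → ℕ
μ R φ = ∣ PCPart φ ∩ R ∣

pc-injective : ∀ {n} {i j : Fin (suc n)} → pc {n} i ≡ pc j → i ≡ j
pc-injective refl = refl

μ-axiom : ∀ {n} (R : Subset (suc n)) {φ : ClauseSet n} → IsAxiom φ → μ R φ ≤ 1
μ-axiom R {φ} (d , _ , only-d) =
  ≤-trans (∣p∩q∣≤∣p∣ (PCPart φ) R) (subsingleton⇒∣p∣≤1 (PCPart φ) same-pigeon)
  where
  is-d : ∀ {x} → x ∈ PCPart φ → pc x ≡ d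
  is-d x∈ = only-d _ (∈-tabulate⁻ (λ i → φ (pc i)) x∈)
  same-pigeon : ∀ {x y} → x ∈ PCPart φ → y ∈ PCPart φ → x ≡ y
  same-pigeon x∈ y∈ = pc-injective (trans (is-d x∈) (sym (is-d y∈)))

μ-join : ∀ {n} (R : Subset (suc n)) {φ φa φb : ClauseSet n} →
         (∀ d → φ d ≡ (φa d ∨ φb d)) → μ R φ ≤ μ R φa + μ R φb
μ-join R {φ} {φa} {φb} join = begin
  ∣ PCPart φ ∩ R ∣                              ≡⟨ cong (λ s → ∣ s ∩ R ∣) PCPart-join ⟩
  ∣ (PCPart φa ∪ PCPart φb) ∩ R ∣               ≡⟨ cong ∣_∣ (∩-distribʳ-∪ R (PCPart φa) (PCPart φb)) ⟩
  ∣ (PCPart φa ∩ R) ∪ (PCPart φb ∩ R) ∣         ≤⟨ ∣p∪q∣≤∣p∣+∣q∣ (PCPart φa ∩ R) (PCPart φb ∩ R) ⟩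
  ∣ PCPart φa ∩ R ∣ + ∣ PCPart φb ∩ R ∣         ∎
  where
  open ≤-Reasoning
  PCPart-join : PCPart φ ≡ PCPart φa ∪ PCPart φb
  PCPart-join = trans (tabulate-cong (λ i → join (pc i)))
                      (tabulate-∨ (λ i → φa (pc i)) (λ i → φb (pc i)))

μ-full : ∀ {n} (R : Subset (suc n)) {φ : ClauseSet n} → (∀ i → φ (pc i) ≡ true) → ∣ R ∣ ≤ μ R φ
μ-full R {φ} all-pc = p⊆q⇒∣p∣≤∣q∣ {p = R} {q = PCPart φ ∩ R} R⊆
  where
  R⊆ : R ⊆ PCPart φ ∩ R
  R⊆ x∈R = x∈p∩q⁺ (∈-tabulate⁺ (λ i → φ (pc i)) (all-pc _) , x∈R)

-- Pigeon i sits in no hole; every other pigeon p sits in hole punchOut (i ≢ p),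
-- which is injective in p.
stayHome : ∀ {n} → Fin (suc n) → Assignment n
stayHome i (p , j) with i ≟ p
... | yes _ = false
... | no i≢p with punchOut i≢p ≟ j
...   | yes _ = true
...   | no _  = false

stayHome-true⇒ : ∀ {n} (i p : Fin (suc n)) (j : Fin n) →
                 stayHome i (p , j) ≡ true → Σ (i ≢ p) λ i≢p → punchOut i≢p ≡ j
stayHome-true⇒ i p j holds with i ≟ p
... | no i≢p with punchOut i≢p ≟ j
...   | yes eq = i≢p , eq

stayHome-flies : ∀ {n} (i p : Fin (suc n)) (i≢p : i ≢ p) → stayHome i (p , punchOut i≢p) ≡ true
stayHome-flies i p i≢p with i ≟ p
... | yes i≡p = ⊥-elim (i≢p i≡p)
... | no i≢p′ with punchOut i≢p′ ≟ punchOut i≢p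
...   | yes _  = refl
...   | no neq = ⊥-elim (neq (FinP.punchOut-cong i refl))

stayHome-sat : ∀ {n} (i : Fin (suc n)) (c : Clause n) → c ≢ pc i → Sat (stayHome i) c
stayHome-sat i (pc p) c≢pci = punchOut i≢p , stayHome-flies i p i≢p
  where
  i≢p : i ≢ p
  i≢p i≡p = c≢pci (cong pc (sym i≡p))
stayHome-sat i (nc p q p<q k) _ with stayHome i (p , k) in ep | stayHome i (q , k) in eq
... | false | _     = inj₁ refl
... | true  | false = inj₂ refl
... | true  | true  with stayHome-true⇒ i p k ep | stayHome-true⇒ i q k eq
...   | i≢p , hp | i≢q , hq =
  ⊥-elim (FinP.<-irrefl (FinP.punchOut-injective i≢p i≢q (trans hp (sym hq))) p<q)

Balanced : ℕ → ℕ → Set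
Balanced N x = N ≤ 4 * x × 4 * x < 2 * N

below-half : ∀ {N a b c} → 4 * a < N → 4 * b < N → c ≤ a + b → 4 * c < 2 * N
below-half {N} {a} {b} {c} a< b< c≤ = begin-strict
  4 * c          ≤⟨ *-monoʳ-≤ 4 c≤ ⟩
  4 * (a + b)    ≡⟨ *-distribˡ-+ 4 a b ⟩
  4 * a + 4 * b  <⟨ +-mono-< a< b< ⟩
  N + N          ≡⟨ cong (N +_) (sym (+-identityʳ N)) ⟩
  2 * N          ∎
  where open ≤-Reasoning

LeafOrJoin : ∀ {l} → (Fin l → ℕ) → ℕ → Fin l → Set
LeafOrJoin {l} w N k = 4 * w k < N ⊎ Σ (Fin l) λ a → Σ (Fin l) λ b → a F.< k × b F.< k × w k ≤ w a + w b

balanced-ancestor : ∀ {l} (w : Fin l → ℕ) (N : ℕ) → (∀ k → LeafOrJoin w N k) →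
                    ∀ k → Acc F._<_ k → N ≤ 4 * w k → Σ (Fin l) λ k′ → Balanced N (w k′)
balanced-ancestor w N shape k (acc below) heavy with shape k
... | inj₁ light = ⊥-elim (<⇒≱ light heavy)
... | inj₂ (a , b , a<k , b<k , sub) with N ≤? 4 * w a | N ≤? 4 * w b
...   | yes heavy-a | _           = balanced-ancestor w N shape a (below a<k) heavy-a
...   | no _        | yes heavy-b = balanced-ancestor w N shape b (below b<k) heavy-b
...   | no light-a  | no light-b  = k , heavy , below-half {N} {w a} {w b} (≰⇒> light-a) (≰⇒> light-b) sub

below-last : ∀ {m} (k : Fin (suc m)) → k ≢ fromℕ m → Σ (Fin m) λ i → inject₁ i ≡ k
below-last {m} k k≢last = lower₁ k m≢k , FinP.inject₁-lower₁ k m≢k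
  where
  m≢k : m ≢ toℕ k
  m≢k m≡k = k≢last (FinP.toℕ-injective (trans (sym m≡k) (sym (FinP.toℕ-fromℕ m))))

module _ {n : ℕ} {O : VarOrder n} {m : ℕ} (P : Refutation n O m) where
  open Refutation P

  -- The final, unsatisfiable step must contain every pigeon clause: otherwise
  -- stayHome i would satisfy all of its clauses, hence also B_l.
  last-contains-pc : ∀ i → cls (fromℕ m) (pc i) ≡ true
  last-contains-pc i with cls (fromℕ m) (pc i) in missing
  ... | true  = refl
  ... | false = ⊥-elim (true≢false (trans (sym satisfied) (final (stayHome i))))
    where
    true≢false : true ≢ false
    true≢false ()
    satisfied : evalB (B (fromℕ m)) (stayHome i) ≡ true
    satisfied = proj₂ (represents (fromℕ m) (stayHome i)) λ d d∈ →
      stayHome-sat i d λ { refl → true≢false (trans (sym d∈) missing) }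

  module _ (R : Subset (suc n)) (big : 4 < ∣ R ∣) where

    w : Fin (suc m) → ℕ
    w k = μ R (cls k)

    refutation-shape : ∀ k → LeafOrJoin w ∣ R ∣ k
    refutation-shape k with step k
    ... | inj₁ axiom = inj₁ (≤-<-trans (*-monoʳ-≤ 4 (μ-axiom R axiom)) big)
    ... | inj₂ (a , b , a<b , b<k , join) =
      inj₂ (a , b , FinP.<-trans a<b b<k , b<k , μ-join R {cls k} {cls a} {cls b} join)

    last-full : ∣ R ∣ ≤ w (fromℕ m)
    last-full = μ-full R {cls (fromℕ m)} last-contains-pc

    last-heavy : ∣ R ∣ ≤ 4 * w (fromℕ m)
    last-heavy = ≤-trans last-full (m≤n*m (w (fromℕ m)) 4)

    last-unbalanced : ¬ Balanced ∣ R ∣ (w (fromℕ m))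
    last-unbalanced (_ , under-half) =
      <⇒≱ under-half (≤-trans (*-monoˡ-≤ ∣ R ∣ {2} {4} (s≤s (s≤s z≤n))) (*-monoʳ-≤ 4 last-full))

    balanced-step : Σ (Fin m) λ i → Balanced ∣ R ∣ (w (inject₁ i))
    balanced-step with balanced-ancestor w ∣ R ∣ refutation-shape (fromℕ m) (<-wellFounded _) last-heavy
    ... | k , balanced with below-last k (λ { refl → last-unbalanced balanced })
    ...   | i , refl = i , balanced

lemma3 : (n : ℕ) (O : VarOrder n) (m : ℕ) (P : Refutation n O m) (R : Subset (suc n)) →
    4 < ∣ R ∣ →
    Σ (Fin m) λ i →
    ∣ R ∣ ≤ 4 * ∣ PCPart (Refutation.cls P (inject₁ i)) ∩ R ∣ ×
    4 * ∣ PCPart (Refutation.cls P (inject₁ i)) ∩ R ∣ < 2 * ∣ R ∣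
lemma3 n O m P R big = balanced-step P R big
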